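{- Let $p\ge3$ be an integer and $u$ an integer coprime to $p$. Let $r_1$ be the integer with $0<r_1<p$ and $ur_1\equiv1\pmod p$, put $r_0=p$, and for $1\le i\le t$ define integers $Z_i$, $r_{i+1}$ by $r_{i-1}=Z_ir_i+r_{i+1}$, $0\le r_{i+1}<r_i$, where $t$ is the index with $r_t=1$ (so $r_{t+1}=0$). Let $D=D(p,u)$ be the set of pairs of integers $(a,b)$ with $a<b$ such that $$\max(\langle ua\rangle_p,\langle ub\rangle_p)<\min_{a<n<b}\langle un\rangle_p$$ (the condition being vacuous when $b=a+1$), and let $D_\Delta=\{b-a : (a,b)\in D\}$. Then $$D_\Delta=\{\,r_{i-1}-zr_i : 1\le i\le t,\ 0\le z\le Z_i-1\,\}.$$
   Context: For an integer $x$, $\langle x\rangle_p$ denotes the least nonnegative residue of $x$ modulo $p$, i.e. $\langle x\rangle_p\equiv x\pmod p$ and $0\le\langle x\rangle_p<p$. -}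

module Defs where

open import Data.Nat as ℕ using (ℕ; zero; suc; _⊔_)
open import Data.Nat.DivMod using (_%_; _/_)
open import Data.Integer as ℤ using (ℤ; +_; _-_; _*_)
open import Data.Integer.DivMod using (_%ℕ_)
open import Data.Product using (_×_; _,_; proj₁; proj₂; ∃; ∃-syntax)

-- least nonnegative residue ⟨ x ⟩_p  (p = 0 case is never used; p ≥ 3)
⟨_⟩[_] : ℤ → ℕ → ℕ
⟨ x ⟩[ zero ] = 0
⟨ x ⟩[ suc k ] = x %ℕ suc k

-- total remainder / quotient on ℕ (divisor 0 gives 0; never used on r_i = 0 within 1 ≤ i ≤ t)
modN : ℕ → ℕ → ℕ
modN a zero = 0
modN a (suc k) = a % suc k

divN : ℕ → ℕ → ℕ
divN a zero = 0
divN a (suc k) = a / suc k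

-- pairs (r_i , r_{i+1}) of the Euclidean algorithm started at r_0 = p, r_1 = r1:
-- r_{i-1} = Z_i r_i + r_{i+1}, 0 ≤ r_{i+1} < r_i
rpair : ℕ → ℕ → ℕ → ℕ × ℕ
rpair p r1 zero = p , r1
rpair p r1 (suc i) = proj₂ (rpair p r1 i) , modN (proj₁ (rpair p r1 i)) (proj₂ (rpair p r1 i))

r : ℕ → ℕ → ℕ → ℕ
r p r1 i = proj₁ (rpair p r1 i)

Z : ℕ → ℕ → ℕ → ℕ
Z p r1 i = divN (r p r1 (i ℕ.∸ 1)) (r p r1 i)

InD : ℕ → ℤ → ℤ → ℤ → Set
InD p u a b = a ℤ.< b ×
  ((n : ℤ) → a ℤ.< n → n ℤ.< b → (⟨ u * a ⟩[ p ] ⊔ ⟨ u * b ⟩[ p ]) ℕ.< ⟨ u * n ⟩[ p ])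

InDΔ : ℕ → ℤ → ℤ → Set
InDΔ p u d = ∃[ a ] ∃[ b ] (InD p u a b × b - a ≡ d)
  where open import Relation.Binary.PropositionalEquality using (_≡_)

InEuc : ℕ → ℕ → ℕ → ℤ → Set
InEuc p r1 t d = ∃[ i ] ∃[ z ] (1 ℕ.≤ i × i ℕ.≤ t × z ℕ.< Z p r1 i ×
  d ≡ + r p r1 (i ℕ.∸ 1) - + z * + r p r1 i)
  where open import Relation.Binary.PropositionalEquality using (_≡_)

{-# OPTIONS --safe #-}
module Submission where

-- Translating a pair (a, b) ∈ D so that its endpoint of smaller residue sits at 0 (after the
-- reflection n ↦ -n, u ↦ -u if necessary) shows that b - a is either p or a record low x of
-- n ↦ ⟨v n⟩ for v = ±u, i.e. ⟨v x⟩ < ⟨v j⟩ for 0 < j < x.  As r₁ inverts u modulo p, x is a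
-- record low of u (of -u) exactly when (x, ⟨u x⟩) (resp. (x, ⟨-u x⟩)) is a relative minimum of
-- the lattice r₁ y ≡ x (of r₁ y ≡ -x).  For p = r + Z s, a point (x, y) of one lattice of
-- (p, s) with multiplier k corresponds to the point (x, k) of the opposite lattice of (s, r), so
-- the gaps of (p, s) are those of (s, r) together with p - z s for z < Z; induction along the
-- Euclidean algorithm then gives the theorem.

open import Data.Nat.Base using (ℕ)
open import Defs

module LatticeMinima where

  open import Data.Nat
  open import Data.Nat.Properties
  open import Data.Nat.Divisibility using (_∣_; divides; quotient; ∣m+n∣m⇒∣n; ∣⇒≤; m%n≡0⇒n∣m)
  open import Data.Nat.DivMod using (_%_; _/_; m≡m%n+[m/n]*n; [m+kn]%n≡m%n; m<n⇒m%n≡m; m%n<n; n/1≡n; n%1≡0)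
  open import Data.Nat.Tactic.RingSolver using (solve)
  open import Data.List.Base using (_∷_; [])
  open import Data.Product using (_×_; _,_; proj₁; proj₂; ∃-syntax)
  open import Data.Sum using (_⊎_; inj₁; inj₂)
  open import Data.Empty using (⊥)
  open import Level using (0ℓ)
  open import Relation.Nullary using (¬_; contradiction; yes; no)
  open import Relation.Binary using (tri<; tri≈; tri>)
  open import Relation.Binary.PropositionalEquality
  open import Function.Bundles using (_⇔_; mk⇔)
  open import Function.Properties.Equivalence using (⇔-setoid)
  open import Function.Construct.Identity using (⇔-id)
  open import Data.Sum.Function.Propositional using (_⊎-⇔_)
  import Relation.Binary.Reasoning.Setoid as SetoidReasoning

  Lattice⁺ Lattice⁻ : ℕ → ℕ → ℕ → ℕ → Set
  Lattice⁺ p s x y = ∃[ k ] s * y ≡ x + k * p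
  Lattice⁻ p s x y = p ∣ x + s * y

  record RelativeMinimum (L : ℕ → ℕ → Set) (p x : ℕ) : Set where
    constructor relMin
    field
      0<x     : 0 < x
      x<p     : x < p
      y       : ℕ
      0<y     : 0 < y
      x,y∈L   : L x y
      minimal : ∀ {x′ y′} → 0 < x′ → x′ < x → 0 < y′ → y′ < y → ¬ L x′ y′

  IsGap : ℕ → ℕ → ℕ → Set
  IsGap p s x = x ≡ p ⊎ RelativeMinimum (Lattice⁺ p s) p x ⊎ RelativeMinimum (Lattice⁻ p s) p x

  Progression : ℕ → ℕ → ℕ → ℕ → Set
  Progression p s Z x = ∃[ z ] z < Z × x + z * s ≡ p

  %-cong-+multiple : ∀ a m b n {s} .{{_ : NonZero s}} → a + m * s ≡ b + n * s → a % s ≡ b % s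
  %-cong-+multiple a m b n {s} eq = begin
    a % s            ≡⟨ [m+kn]%n≡m%n a m s ⟨
    (a + m * s) % s  ≡⟨ cong (_% s) eq ⟩
    (b + n * s) % s  ≡⟨ [m+kn]%n≡m%n b n s ⟩
    b % s            ∎
    where open ≡-Reasoning

  residues-distinct : ∀ {a b c s} → a < b → b < s → s ∣ a + c → s ∣ b + c → ⊥
  residues-distinct {a} {b} {c} {s} a<b b<s s∣a+c s∣b+c =
    <⇒≱ (≤-<-trans (m∸n≤m b a) b<s) (∣⇒≤ {{>-nonZero (m<n⇒0<n∸m a<b)}} s∣b∸a)
    where
    swap : ∀ d → a + c + d ≡ a + d + c
    swap d = solve (a ∷ c ∷ d ∷ [])
    rearranged : a + c + (b ∸ a) ≡ b + c
    rearranged = trans (swap (b ∸ a)) (cong (_+ c) (m+[n∸m]≡n (<⇒≤ a<b)))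
    s∣b∸a : s ∣ b ∸ a
    s∣b∸a = ∣m+n∣m⇒∣n (subst (s ∣_) (sym rearranged) s∣b+c) s∣a+c

  positive-multiplicand : ∀ m {n a b} → 0 < a → m * n ≡ a + b → 0 < n
  positive-multiplicand m {zero} 0<a eq =
    contradiction (trans (sym (*-zeroʳ m)) eq) (<⇒≢ (<-≤-trans 0<a (m≤m+n _ _)))
  positive-multiplicand m {suc n} _ _ = z<s

  lattice⁺-multiplier>0 : ∀ {s x y k p} → x < s → 0 < y → s * y ≡ x + k * p → 0 < k
  lattice⁺-multiplier>0 {s} {x} {y} {zero} x<s 0<y eq = contradiction 0<y (<⇒≱ y<1)
    where
    open ≤-Reasoning
    y<1 : y < 1
    y<1 = *-cancelˡ-< s y 1 (begin-strict
      s * y   ≡⟨ eq ⟩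
      x + 0   ≡⟨ +-identityʳ x ⟩
      x       <⟨ x<s ⟩
      s       ≡⟨ *-identityʳ s ⟨
      s * 1   ∎)
  lattice⁺-multiplier>0 {k = suc _} _ _ _ = z<s

  lattice⁻-multiplier>0 : ∀ {s x y k p} → 0 < x → x + s * y ≡ k * p → 0 < k
  lattice⁻-multiplier>0 {x = x} {k = zero} 0<x eq = contradiction (m+n≡0⇒m≡0 x eq) (>⇒≢ 0<x)
  lattice⁻-multiplier>0 {k = suc _} _ _ = z<s

  lattice⁻-height>0 : ∀ {s x y k p} → x < p → 0 < k → x + s * y ≡ k * p → 0 < y
  lattice⁻-height>0 {s} {x} {zero} {suc k} {p} x<p _ eq = contradiction x<p (≤⇒≯ p≤x)
    where
    open ≤-Reasoning
    p≤x : p ≤ x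
    p≤x = begin
      p             ≤⟨ m≤m+n p (k * p) ⟩
      suc k * p     ≡⟨ eq ⟨
      x + s * 0     ≡⟨ cong (x +_) (*-zeroʳ s) ⟩
      x + 0         ≡⟨ +-identityʳ x ⟩
      x             ∎
  lattice⁻-height>0 {y = suc _} _ _ _ = z<s

  divisor∈lattice⁺ : ∀ {p s} → Lattice⁺ p s s 1
  divisor∈lattice⁺ {s = s} = 0 , trans (*-identityʳ s) (sym (+-identityʳ s))

  divisor-minimal : ∀ {p s} → 0 < s → s < p → RelativeMinimum (Lattice⁺ p s) p s
  divisor-minimal 0<s s<p = relMin 0<s s<p 1 z<s divisor∈lattice⁺ λ _ _ 0<y′ y′<1 _ → <⇒≱ y′<1 0<y′

  minimal⁺-beyond : ∀ {p s x} → 0 < s → s < x → ¬ RelativeMinimum (Lattice⁺ p s) p x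
  minimal⁺-beyond {p} {s} {x} 0<s s<x (relMin _ _ y _ (k , sy≡x+kp) minimal) =
    minimal 0<s s<x z<s 1<y divisor∈lattice⁺
    where
    open ≤-Reasoning
    1<y : 1 < y
    1<y = *-cancelˡ-< s 1 y (begin-strict
      s * 1       ≡⟨ *-identityʳ s ⟩
      s           <⟨ s<x ⟩
      x           ≤⟨ m≤m+n x (k * p) ⟩
      x + k * p   ≡⟨ sy≡x+kp ⟨
      s * y       ∎)

  module EuclideanStep {p s Z r : ℕ} (p≡r+Z*s : p ≡ r + Z * s) (0<s : 0 < s) (s<p : s < p) (r<s : r < s) where

    private
      instance
        s-nonZero : NonZero s
        s-nonZero = >-nonZero 0<s

    Z*s≤p : Z * s ≤ p
    Z*s≤p = subst (Z * s ≤_) (sym p≡r+Z*s) (m≤n+m (Z * s) r)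

    0<Z : 0 < Z
    0<Z = n≢0⇒n>0 λ { refl → <-irrefl (sym (trans p≡r+Z*s (+-identityʳ r))) (<-trans r<s s<p) }

    k*p≡r*k+k*Z*s : ∀ k → k * p ≡ r * k + k * Z * s
    k*p≡r*k+k*Z*s k = begin
      k * p               ≡⟨ cong (k *_) p≡r+Z*s ⟩
      k * (r + Z * s)     ≡⟨ solve (k ∷ r ∷ Z ∷ s ∷ []) ⟩
      r * k + k * Z * s   ∎
      where open ≡-Reasoning

    lattice⁺-descend : ∀ {x y k} → s * y ≡ x + k * p → Lattice⁻ s r x k
    lattice⁺-descend {x} {y} {k} eq = m%n≡0⇒n∣m (x + r * k) s (trans (%-cong-+multiple (x + r * k) (k * Z) 0 y (begin
      x + r * k + k * Z * s     ≡⟨ +-assoc x (r * k) _ ⟩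
      x + (r * k + k * Z * s)   ≡⟨ cong (x +_) (k*p≡r*k+k*Z*s k) ⟨
      x + k * p                 ≡⟨ eq ⟨
      s * y                     ≡⟨ *-comm s y ⟩
      0 + y * s                 ∎)) (m<n⇒m%n≡m 0<s))
      where open ≡-Reasoning

    lattice⁻-descend : ∀ {x y k} → x < s → x + s * y ≡ k * p → Lattice⁺ s r x k
    lattice⁻-descend {x} {y} {k} x<s eq = r * k / s , (begin
      r * k                       ≡⟨ m≡m%n+[m/n]*n (r * k) s ⟩
      r * k % s + r * k / s * s   ≡⟨ cong (_+ r * k / s * s) r*k%s≡x ⟩
      x + r * k / s * s           ∎)
      where
      open ≡-Reasoning
      r*k%s≡x : r * k % s ≡ x
      r*k%s≡x = trans (%-cong-+multiple (r * k) (k * Z) x y (begin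
        r * k + k * Z * s   ≡⟨ k*p≡r*k+k*Z*s k ⟨
        k * p               ≡⟨ eq ⟨
        x + s * y           ≡⟨ cong (x +_) (*-comm s y) ⟩
        x + y * s           ∎)) (m<n⇒m%n≡m x<s)

    lattice⁻-ascend : ∀ {x k} (s∣ : s ∣ x + r * k) → s * (quotient s∣ + k * Z) ≡ x + k * p
    lattice⁻-ascend {x} {k} (divides m eq) = begin
      s * (m + k * Z)           ≡⟨ solve (s ∷ m ∷ k ∷ Z ∷ []) ⟩
      m * s + k * Z * s         ≡⟨ cong (_+ k * Z * s) eq ⟨
      x + r * k + k * Z * s     ≡⟨ +-assoc x (r * k) _ ⟩
      x + (r * k + k * Z * s)   ≡⟨ cong (x +_) (k*p≡r*k+k*Z*s k) ⟨
      x + k * p                 ∎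
      where open ≡-Reasoning

    lattice⁺-ascend : ∀ {x k m} → r * k ≡ x + m * s → x + s * (m + k * Z) ≡ k * p
    lattice⁺-ascend {x} {k} {m} eq = begin
      x + s * (m + k * Z)       ≡⟨ solve (x ∷ s ∷ m ∷ k ∷ Z ∷ []) ⟩
      x + m * s + k * Z * s     ≡⟨ cong (_+ k * Z * s) eq ⟨
      r * k + k * Z * s         ≡⟨ k*p≡r*k+k*Z*s k ⟨
      k * p                     ∎
      where open ≡-Reasoning

    minimal⁺-descend : ∀ {x} → x < s → RelativeMinimum (Lattice⁺ p s) p x → RelativeMinimum (Lattice⁻ s r) s x
    minimal⁺-descend {x} x<s (relMin 0<x x<p y 0<y (k , sy≡x+kp) minimal) =
      relMin 0<x x<s k (lattice⁺-multiplier>0 x<s 0<y sy≡x+kp) (lattice⁺-descend sy≡x+kp) minimal′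
      where
      minimal′ : ∀ {x′ k′} → 0 < x′ → x′ < x → 0 < k′ → k′ < k → ¬ Lattice⁻ s r x′ k′
      minimal′ {x′} {k′} 0<x′ x′<x _ k′<k s∣ =
        minimal 0<x′ x′<x (positive-multiplicand s 0<x′ (lattice⁻-ascend s∣)) y′<y (k′ , lattice⁻-ascend s∣)
        where
        open ≤-Reasoning
        y′<y : quotient s∣ + k′ * Z < y
        y′<y = *-cancelˡ-< s _ y (begin-strict
          s * (quotient s∣ + k′ * Z)   ≡⟨ lattice⁻-ascend s∣ ⟩
          x′ + k′ * p                  <⟨ +-mono-<-≤ x′<x (*-monoˡ-≤ p (<⇒≤ k′<k)) ⟩
          x + k * p                    ≡⟨ sy≡x+kp ⟨
          s * y                        ∎)

    minimal⁻-ascend : ∀ {x} → RelativeMinimum (Lattice⁻ s r) s x → RelativeMinimum (Lattice⁺ p s) p x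
    minimal⁻-ascend {x} (relMin 0<x x<s k 0<k s∣ minimal) =
      relMin 0<x (<-trans x<s s<p) y (positive-multiplicand s 0<x sy≡x+kp) (k , sy≡x+kp) minimal′
      where
      y = quotient s∣ + k * Z
      sy≡x+kp = lattice⁻-ascend s∣
      minimal′ : ∀ {x′ y′} → 0 < x′ → x′ < x → 0 < y′ → y′ < y → ¬ Lattice⁺ p s x′ y′
      minimal′ {x′} {y′} 0<x′ x′<x 0<y′ y′<y (k′ , sy′≡x′+k′p) with <-cmp k′ k
      ... | tri< k′<k _ _ =
        minimal 0<x′ x′<x (lattice⁺-multiplier>0 (<-trans x′<x x<s) 0<y′ sy′≡x′+k′p) k′<k
          (lattice⁺-descend sy′≡x′+k′p)
      ... | tri≈ _ refl _ = residues-distinct x′<x x<s (lattice⁺-descend sy′≡x′+k′p) s∣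
      ... | tri> _ _ k<k′ = <-asym y′<y (*-cancelˡ-< s y y′ (begin-strict
          s * y         ≡⟨ sy≡x+kp ⟩
          x + k * p     <⟨ +-monoˡ-< (k * p) (<-trans x<s s<p) ⟩
          suc k * p     ≤⟨ *-monoˡ-≤ p k<k′ ⟩
          k′ * p        ≤⟨ m≤n+m (k′ * p) x′ ⟩
          x′ + k′ * p   ≡⟨ sy′≡x′+k′p ⟨
          s * y′        ∎))
        where open ≤-Reasoning

    minimal⁻-descend : ∀ {x} → x < s → RelativeMinimum (Lattice⁻ p s) p x → RelativeMinimum (Lattice⁺ s r) s x
    minimal⁻-descend {x} x<s (relMin 0<x x<p y 0<y (divides k x+sy≡kp) minimal) =
      relMin 0<x x<s k (lattice⁻-multiplier>0 {s = s} 0<x x+sy≡kp) (lattice⁻-descend x<s x+sy≡kp) minimal′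
      where
      minimal′ : ∀ {x′ k′} → 0 < x′ → x′ < x → 0 < k′ → k′ < k → ¬ Lattice⁺ s r x′ k′
      minimal′ {x′} {k′} 0<x′ x′<x 0<k′ k′<k (m′ , rk′≡x′+m′s) =
        minimal 0<x′ x′<x (lattice⁻-height>0 {s = s} (<-trans x′<x x<p) 0<k′ x′+sY≡k′p) Y<y
          (divides k′ x′+sY≡k′p)
        where
        Y = m′ + k′ * Z
        x′+sY≡k′p = lattice⁺-ascend rk′≡x′+m′s
        open ≤-Reasoning
        Y<y : Y < y
        Y<y = ≰⇒> λ y≤Y → <-irrefl refl (begin-strict
          x + s * y          <⟨ +-monoˡ-< (s * y) x<p ⟩
          p + s * y          ≤⟨ +-monoʳ-≤ p (*-monoʳ-≤ s y≤Y) ⟩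
          p + s * Y          ≤⟨ +-monoʳ-≤ p (m≤n+m (s * Y) x′) ⟩
          p + (x′ + s * Y)   ≡⟨ cong (p +_) x′+sY≡k′p ⟩
          suc k′ * p         ≤⟨ *-monoˡ-≤ p k′<k ⟩
          k * p              ≡⟨ x+sy≡kp ⟨
          x + s * y          ∎)

    minimal⁻-above-remainder : ∀ {x} → 0 < r → r < x → RelativeMinimum (Lattice⁻ p s) p x → Progression p s Z x
    minimal⁻-above-remainder {x} _ _ (relMin 0<x _ _ _ (divides zero x+sy≡0) _) =
      contradiction (m+n≡0⇒m≡0 x x+sy≡0) (>⇒≢ 0<x)
    minimal⁻-above-remainder {x} _ r<x (relMin _ _ y _ (divides 1 x+sy≡p+0) _) with y <? Z
    ... | yes y<Z = y , y<Z , trans (cong (x +_) (*-comm y s)) (trans x+sy≡p+0 (+-identityʳ p))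
    ... | no y≮Z = contradiction (begin-strict
          p               ≡⟨ p≡r+Z*s ⟩
          r + Z * s       <⟨ +-mono-<-≤ r<x (≤-trans (*-monoˡ-≤ s (≮⇒≥ y≮Z)) (≤-reflexive (*-comm y s))) ⟩
          x + s * y       ≡⟨ x+sy≡p+0 ⟩
          p + 0           ≡⟨ +-identityʳ p ⟩
          p               ∎) (<-irrefl refl)
      where open ≤-Reasoning
    minimal⁻-above-remainder {x} 0<r r<x (relMin _ x<p y _ (divides (suc (suc k)) x+sy≡kp) minimal) =
      contradiction (divides 1 r+sZ≡p+0) (minimal 0<r r<x 0<Z Z<y)
      where
      open ≤-Reasoning
      r+sZ≡p+0 : r + s * Z ≡ 1 * p
      r+sZ≡p+0 = trans (cong (r +_) (*-comm s Z)) (trans (sym p≡r+Z*s) (sym (+-identityʳ p)))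
      Z<y : Z < y
      Z<y = ≰⇒> λ y≤Z → <-irrefl refl (begin-strict
        x + s * y              <⟨ +-mono-<-≤ x<p (*-monoʳ-≤ s y≤Z) ⟩
        p + s * Z              ≤⟨ +-monoʳ-≤ p (≤-trans (≤-reflexive (*-comm s Z)) Z*s≤p) ⟩
        p + p                  ≤⟨ +-monoʳ-≤ p (m≤m+n p _) ⟩
        suc (suc k) * p        ≡⟨ x+sy≡kp ⟨
        x + s * y              ∎)

    minimal⁺-ascend : ∀ {x} → RelativeMinimum (Lattice⁺ s r) s x → RelativeMinimum (Lattice⁻ p s) p x
    minimal⁺-ascend {x} (relMin 0<x x<s k 0<k (m , rk≡x+ms) minimal) =
      relMin 0<x x<p Y (lattice⁻-height>0 {s = s} x<p 0<k x+sY≡kp) (divides k x+sY≡kp) minimal′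
      where
      x<p = <-trans x<s s<p
      Y = m + k * Z
      x+sY≡kp = lattice⁺-ascend rk≡x+ms
      minimal′ : ∀ {x′ y′} → 0 < x′ → x′ < x → 0 < y′ → y′ < Y → ¬ Lattice⁻ p s x′ y′
      minimal′ {x′} {y′} 0<x′ x′<x _ y′<Y (divides k′ x′+sy′≡k′p) =
        minimal 0<x′ x′<x (lattice⁻-multiplier>0 {s = s} 0<x′ x′+sy′≡k′p) k′<k
          (lattice⁻-descend (<-trans x′<x x<s) x′+sy′≡k′p)
        where
        open ≤-Reasoning
        k′<k : k′ < k
        k′<k = *-cancelʳ-< p k′ k (begin-strict
          k′ * p        ≡⟨ x′+sy′≡k′p ⟨
          x′ + s * y′   <⟨ +-mono-<-≤ x′<x (*-monoʳ-≤ s (<⇒≤ y′<Y)) ⟩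
          x + s * Y     ≡⟨ x+sY≡kp ⟩
          k * p         ∎)

    progression⇒gap : ∀ {x} → Progression p s Z x → IsGap p s x
    progression⇒gap {x} (zero , _ , x+0≡p) = inj₁ (trans (sym (+-identityʳ x)) x+0≡p)
    progression⇒gap {x} (suc z , z<Z , x+zs≡p) =
      inj₂ (inj₂ (relMin 0<x x<p (suc z) z<s (divides 1 x+sz≡p+0) minimal))
      where
      open ≤-Reasoning
      x+sz≡p+0 : x + s * suc z ≡ 1 * p
      x+sz≡p+0 = trans (cong (x +_) (*-comm s (suc z))) (trans x+zs≡p (sym (+-identityʳ p)))
      0<x : 0 < x
      0<x = n≢0⇒n>0 λ { refl → <-irrefl refl (begin-strict
        p            ≡⟨ x+zs≡p ⟨
        suc z * s    <⟨ *-monoˡ-< s z<Z ⟩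
        Z * s        ≤⟨ Z*s≤p ⟩
        p            ∎) }
      x<p : x < p
      x<p = begin-strict
        x               <⟨ m<m+n x (≤-trans 0<s (m≤m+n s (z * s))) ⟩
        x + suc z * s   ≡⟨ x+zs≡p ⟩
        p               ∎
      minimal : ∀ {x′ y′} → 0 < x′ → x′ < x → 0 < y′ → y′ < suc z → ¬ Lattice⁻ p s x′ y′
      minimal {x′} {y′} 0<x′ x′<x _ y′<1+z (divides k′ x′+sy′≡k′p) = <-irrefl refl (begin-strict
        x′ + s * y′     <⟨ +-mono-<-≤ x′<x (*-monoʳ-≤ s (<⇒≤ y′<1+z)) ⟩
        x + s * suc z   ≡⟨ x+sz≡p+0 ⟩
        1 * p           ≤⟨ *-monoˡ-≤ p (lattice⁻-multiplier>0 {s = s} {k = k′} 0<x′ x′+sy′≡k′p) ⟩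
        k′ * p          ≡⟨ x′+sy′≡k′p ⟨
        x′ + s * y′     ∎)

    gap-step : 0 < r → ∀ x → IsGap p s x ⇔ (Progression p s Z x ⊎ IsGap s r x)
    gap-step 0<r x = mk⇔ to from
      where
      to : ∀ {x} → IsGap p s x → Progression p s Z x ⊎ IsGap s r x
      to {x} (inj₁ x≡p) = inj₁ (0 , 0<Z , trans (+-identityʳ x) x≡p)
      to {x} (inj₂ (inj₁ m)) with <-cmp x s
      ... | tri< x<s _ _ = inj₂ (inj₂ (inj₂ (minimal⁺-descend x<s m)))
      ... | tri≈ _ x≡s _ = inj₂ (inj₁ x≡s)
      ... | tri> _ _ s<x = contradiction m (minimal⁺-beyond 0<s s<x)
      to {x} (inj₂ (inj₂ m)) with <-cmp x r
      ... | tri< x<r _ _ = inj₂ (inj₂ (inj₁ (minimal⁻-descend (<-trans x<r r<s) m)))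
      ... | tri≈ _ refl _ = inj₂ (inj₂ (inj₁ (divisor-minimal 0<r r<s)))
      ... | tri> _ _ r<x = inj₁ (minimal⁻-above-remainder 0<r r<x m)
      from : ∀ {x} → Progression p s Z x ⊎ IsGap s r x → IsGap p s x
      from (inj₁ x∈progression) = progression⇒gap x∈progression
      from (inj₂ (inj₁ refl)) = inj₂ (inj₁ (divisor-minimal 0<s s<p))
      from (inj₂ (inj₂ (inj₁ m))) = inj₂ (inj₂ (minimal⁺-ascend m))
      from (inj₂ (inj₂ (inj₂ m))) = inj₂ (inj₁ (minimal⁻-ascend m))

  unit-progression : ∀ {p x} → 0 < x → x ≤ p → Progression p 1 p x
  unit-progression {p} {x} 0<x x≤p =
    p ∸ x , ∸-monoʳ-< 0<x x≤p , trans (cong (x +_) (*-identityʳ (p ∸ x))) (m+[n∸m]≡n x≤p)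

  gap-unit : ∀ {p} → 1 < p → ∀ x → IsGap p 1 x ⇔ Progression p 1 p x
  gap-unit {p} 1<p x = mk⇔ to progression⇒gap
    where
    open EuclideanStep {p} {1} {p} {0} (sym (*-identityʳ p)) z<s 1<p z<s
    open RelativeMinimum
    to : ∀ {x} → IsGap p 1 x → Progression p 1 p x
    to {x} (inj₁ x≡p) = 0 , 0<Z , trans (+-identityʳ x) x≡p
    to (inj₂ (inj₁ m)) = unit-progression (0<x m) (≤-trans (≮⇒≥ λ 1<x → minimal⁺-beyond z<s 1<x m) (<⇒≤ 1<p))
    to (inj₂ (inj₂ m)) = unit-progression (0<x m) (<⇒≤ (x<p m))

  EuclidStep : ℕ × ℕ → ℕ → Set
  EuclidStep q = Progression (proj₁ q) (proj₂ q) (divN (proj₁ q) (proj₂ q))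

  -- Step i of EuclidGaps is step i + 1 of InEuc: rpair p s i = (r_i, r_{i+1}).
  EuclidGaps : ℕ → ℕ → ℕ → ℕ → Set
  EuclidGaps p s t x = ∃[ i ] i < t × EuclidStep (rpair p s i) x

  rpair-suc : ∀ p s i → rpair p s (suc i) ≡ rpair s (modN p s) i
  rpair-suc p s zero = refl
  rpair-suc p s (suc i) = cong (λ q → proj₂ q , modN (proj₁ q) (proj₂ q)) (rpair-suc p s i)

  r-suc : ∀ p s i → r p s (suc i) ≡ r s (modN p s) i
  r-suc p s i = cong proj₁ (rpair-suc p s i)

  r-0-0 : ∀ t → r 0 0 t ≡ 0
  r-0-0 zero = refl
  r-0-0 (suc t) = trans (r-suc 0 0 t) (r-0-0 t)

  r-zero-remainder : ∀ {a} t → r a 0 t ≡ 1 → t ≡ 0 × a ≡ 1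
  r-zero-remainder zero a≡1 = refl , a≡1
  r-zero-remainder {a} (suc t) r≡1 = contradiction (trans (sym (trans (r-suc a 0 t) (r-0-0 t))) r≡1) λ ()

  euclid-single : ∀ {p s x} → EuclidGaps p s 1 x ⇔ EuclidStep (p , s) x
  euclid-single = mk⇔ (λ { (zero , _ , step) → step ; (suc _ , s≤s () , _) }) (λ step → zero , z<s , step)

  euclid-step : ∀ p s t x → EuclidGaps p s (suc t) x ⇔ (EuclidStep (p , s) x ⊎ EuclidGaps s (modN p s) t x)
  euclid-step p s t x = mk⇔ to from
    where
    to : EuclidGaps p s (suc t) x → EuclidStep (p , s) x ⊎ EuclidGaps s (modN p s) t x
    to (zero , _ , step) = inj₁ step
    to (suc i , s≤s i<t , step) = inj₂ (i , i<t , subst (λ q → EuclidStep q x) (rpair-suc p s i) step)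
    from : EuclidStep (p , s) x ⊎ EuclidGaps s (modN p s) t x → EuclidGaps p s (suc t) x
    from (inj₁ step) = zero , z<s , step
    from (inj₂ (i , i<t , step)) = suc i , s≤s i<t , subst (λ q → EuclidStep q x) (sym (rpair-suc p s i)) step

  gap⇔euclid : ∀ t {p s} → 0 < s → s < p → r p s t ≡ 1 → ∀ x → IsGap p s x ⇔ EuclidGaps p s t x
  gap⇔euclid zero 0<s s<p refl x = contradiction 0<s (<⇒≱ s<p)
  gap⇔euclid (suc t) {p} {1} _ 1<p rt x
    with r-zero-remainder t (subst (λ m → r 1 m t ≡ 1) (n%1≡0 p) (trans (sym (r-suc p 1 t)) rt))
  ... | refl , _ = begin
    IsGap p 1 x            ≈⟨ gap-unit 1<p x ⟩
    Progression p 1 p x    ≡⟨ cong (λ Z → Progression p 1 Z x) (sym (n/1≡n p)) ⟩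
    EuclidStep (p , 1) x   ≈⟨ euclid-single ⟨
    EuclidGaps p 1 1 x     ∎
    where open SetoidReasoning (⇔-setoid 0ℓ)
  gap⇔euclid (suc t) {p} {s@(suc (suc _))} 0<s s<p rt x = begin
    IsGap p s x                                                   ≈⟨ gap-step 0<r x ⟩
    (Progression p s (divN p s) x ⊎ IsGap s (modN p s) x)         ≈⟨ ⇔-id _ ⊎-⇔ gap⇔euclid t 0<r r<s rt′ x ⟩
    (Progression p s (divN p s) x ⊎ EuclidGaps s (modN p s) t x)  ≈⟨ euclid-step p s t x ⟨
    EuclidGaps p s (suc t) x                                      ∎
    where
    open SetoidReasoning (⇔-setoid 0ℓ)
    rt′ : r s (modN p s) t ≡ 1
    rt′ = trans (sym (r-suc p s t)) rt
    0<r : 0 < modN p s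
    0<r = n≢0⇒n>0 λ r≡0 → contradiction (proj₂ (r-zero-remainder t (subst (λ m → r s m t ≡ 1) r≡0 rt′))) λ ()
    r<s : modN p s < s
    r<s = m%n<n p s
    open EuclideanStep {Z = divN p s} (m≡m%n+[m/n]*n p s) 0<s s<p r<s

module Residues (k : ℕ) where

  open import Data.Nat.Base as ℕ using (ℕ; suc; _<_; _≤_; _⊔_; _∸_; z<s)
  open import Data.Nat.Properties
    using (<-cmp; <-trans; <-≤-trans; ≤-<-trans; ≤-trans; ≤-reflexive; <⇒≤; <⇒≢; >⇒≢; <⇒≱; <-asym;
           n≢0⇒n>0; m∸n≤m; m<n⇒0<n∸m; ≮⇒≥; n≮0; m⊔n<o⇒m<o; m⊔n<o⇒n<o; ∸-monoˡ-<; ⊔-comm; ≤-total;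
           module ≤-Reasoning)
  open import Data.Nat.DivMod using (_%_; _/_; m≡m%n+[m/n]*n; m<n⇒m%n≡m; m%n≤m)
  import Data.Nat.Divisibility as ℕ
  open import Data.Integer.Base as ℤ using (ℤ; +_; -[1+_]; -_; _+_; _-_; _*_; ∣_∣; 0ℤ; 1ℤ; _⊖_; +<+; _%ℕ_; _/ℕ_)
  open import Data.Integer.Properties
    using (+-inverseʳ; +-identityˡ; +-identityʳ; *-zeroʳ; *-identityʳ; *-comm; pos-+; pos-*; ⊖-≥; ∣⊖∣-<;
           [+m]-[+n]≡m⊖n; +-minus-telescope; neg-involutive; neg-mono-<; +-monoʳ-<; +-monoˡ-<)
  open import Data.Integer.DivMod using (n%ℕd<d; a≡a%ℕn+[a/ℕn]*n)
  open import Data.Integer.Divisibility.Signed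
    using (_∣_; divides; ∣ᵤ⇒∣; ∣⇒∣ᵤ; ∣m∣n⇒∣m+n; ∣m∣n⇒∣m-n; ∣m⇒∣-m; ∣n⇒∣m*n)
  open import Data.Integer.Tactic.RingSolver using (solve-∀)
  open import Data.Product using (_×_; _,_; ∃-syntax)
  open import Data.Sum using (_⊎_; inj₁; inj₂; [_,_]′)
  open import Function.Base using (_∘_)
  open import Function.Bundles using (_⇔_; mk⇔; Equivalence)
  open import Level using (0ℓ)
  open import Relation.Binary using (Setoid; tri<; tri≈; tri>)
  open import Relation.Binary.PropositionalEquality
  import Relation.Binary.Reasoning.Setoid as SetoidReasoning
  open import Relation.Nullary using (¬_; contradiction)
  open LatticeMinima using (Lattice⁺; Lattice⁻; RelativeMinimum; relMin; IsGap)

  -- The modulus is written suc k so that ⟨_⟩[ p ] computes to _%ℕ_.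
  p : ℕ
  p = suc k

  private
    neg-minus : ∀ a b → - (a - b) ≡ b - a
    neg-minus = solve-∀
    minus-minus : ∀ a b c d → (a - b) - (c - d) ≡ (a - c) - (b - d)
    minus-minus = solve-∀
    *-distribˡ-minus : ∀ c a b → c * (a - b) ≡ c * a - c * b
    *-distribˡ-minus = solve-∀
    plus-minusˡ : ∀ a b → a + b - a ≡ b
    plus-minusˡ = solve-∀
    plus-minus-neg : ∀ a b c → a + b * c ≡ a - (- b * c)
    plus-minus-neg = solve-∀
    neg-*-neg : ∀ a b → - a * - b ≡ a * b
    neg-*-neg = solve-∀
    neg-*-swap : ∀ a b → - a * b ≡ a * - b
    neg-*-swap = solve-∀
    *-rotate : ∀ a b c → a * (b * c) ≡ c * (a * b)
    *-rotate = solve-∀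
    plus-minus-cancel : ∀ a b → a + (b - a) ≡ b
    plus-minus-cancel = solve-∀
    neg-minus-neg : ∀ a b → - a - - b ≡ b - a
    neg-minus-neg = solve-∀

  -- A record rather than a synonym, so that a and b can be inferred from a ≋ b.
  infix 4 _≋_
  record _≋_ (a b : ℤ) : Set where
    constructor mk≋
    field p∣a-b : + p ∣ a - b

  ≋-reflexive : ∀ {a b} → a ≡ b → a ≋ b
  ≋-reflexive {a} refl = mk≋ (divides 0ℤ (+-inverseʳ a))

  ≋-sym : ∀ {a b} → a ≋ b → b ≋ a
  ≋-sym {a} {b} (mk≋ p∣a-b) = mk≋ (subst (+ p ∣_) (neg-minus a b) (∣m⇒∣-m p∣a-b))

  ≋-trans : ∀ {a b c} → a ≋ b → b ≋ c → a ≋ c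
  ≋-trans {a} {b} {c} (mk≋ p∣a-b) (mk≋ p∣b-c) =
    mk≋ (subst (+ p ∣_) (+-minus-telescope a b c) (∣m∣n⇒∣m+n p∣a-b p∣b-c))

  ≋-setoid : Setoid 0ℓ 0ℓ
  ≋-setoid = record
    { Carrier       = ℤ
    ; _≈_           = _≋_
    ; isEquivalence = record { refl = ≋-reflexive refl ; sym = ≋-sym ; trans = ≋-trans }
    }

  ≋-minus : ∀ {a b c d} → a ≋ b → c ≋ d → a - c ≋ b - d
  ≋-minus {a} {b} {c} {d} (mk≋ p∣a-b) (mk≋ p∣c-d) =
    mk≋ (subst (+ p ∣_) (minus-minus a b c d) (∣m∣n⇒∣m-n p∣a-b p∣c-d))

  ≋-*ˡ : ∀ c {a b} → a ≋ b → c * a ≋ c * b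
  ≋-*ˡ c {a} {b} (mk≋ p∣a-b) = mk≋ (subst (+ p ∣_) (*-distribˡ-minus c a b) (∣n⇒∣m*n c p∣a-b))

  +-multiple≋ : ∀ a q → a + q * + p ≋ a
  +-multiple≋ a q = mk≋ (divides q (plus-minusˡ a (q * + p)))

  ≋-residue : ∀ a → a ≋ + ⟨ a ⟩[ p ]
  ≋-residue a = subst (_≋ + ⟨ a ⟩[ p ]) (sym (a≡a%ℕn+[a/ℕn]*n a p)) (+-multiple≋ (+ ⟨ a ⟩[ p ]) (a /ℕ p))

  ≋-distinct : ∀ {x y} → x < y → y < p → ¬ + x ≋ + y
  ≋-distinct {x} {y} x<y y<p (mk≋ p∣x-y) =
    <⇒≱ (≤-<-trans (m∸n≤m y x) y<p) (ℕ.∣⇒≤ {{ℕ.>-nonZero (m<n⇒0<n∸m x<y)}} p∣y∸x)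
    where
    p∣y∸x : p ℕ.∣ y ∸ x
    p∣y∸x = subst (p ℕ.∣_) (trans (cong ∣_∣ ([+m]-[+n]≡m⊖n x y)) (∣⊖∣-< x<y)) (∣⇒∣ᵤ p∣x-y)

  ≋⇒≡ : ∀ {x y} → x < p → y < p → + x ≋ + y → x ≡ y
  ≋⇒≡ {x} {y} x<p y<p x≋y with <-cmp x y
  ... | tri< x<y _ _ = contradiction x≋y (≋-distinct x<y y<p)
  ... | tri≈ _ x≡y _ = x≡y
  ... | tri> _ _ y<x = contradiction (≋-sym x≋y) (≋-distinct y<x x<p)

  residue-unique : ∀ {a w} → w < p → a ≋ + w → ⟨ a ⟩[ p ] ≡ w
  residue-unique {a} w<p a≋w = ≋⇒≡ (n%ℕd<d a p) w<p (≋-trans (≋-sym (≋-residue a)) a≋w)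

  residue-cong : ∀ {a b} → a ≋ b → ⟨ a ⟩[ p ] ≡ ⟨ b ⟩[ p ]
  residue-cong {a} {b} a≋b = residue-unique (n%ℕd<d b p) (≋-trans a≋b (≋-residue b))

  residue-minus : ∀ a b → ⟨ a ⟩[ p ] ≤ ⟨ b ⟩[ p ] → ⟨ b - a ⟩[ p ] ≡ ⟨ b ⟩[ p ] ∸ ⟨ a ⟩[ p ]
  residue-minus a b ⟨a⟩≤⟨b⟩ = residue-unique (≤-<-trans (m∸n≤m ⟨ b ⟩[ p ] ⟨ a ⟩[ p ]) (n%ℕd<d b p)) (begin
    b - a                          ≈⟨ ≋-minus (≋-residue b) (≋-residue a) ⟩
    + ⟨ b ⟩[ p ] - + ⟨ a ⟩[ p ]     ≡⟨ [+m]-[+n]≡m⊖n ⟨ b ⟩[ p ] ⟨ a ⟩[ p ] ⟩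
    ⟨ b ⟩[ p ] ⊖ ⟨ a ⟩[ p ]         ≡⟨ ⊖-≥ ⟨a⟩≤⟨b⟩ ⟩
    + (⟨ b ⟩[ p ] ∸ ⟨ a ⟩[ p ])     ∎)
    where open SetoidReasoning ≋-setoid

  residue-*0 : ∀ v → ⟨ v * 0ℤ ⟩[ p ] ≡ 0
  residue-*0 v = cong ⟨_⟩[ p ] (*-zeroʳ v)

  residue-*p : ∀ v → ⟨ v * + p ⟩[ p ] ≡ 0
  residue-*p v = residue-unique z<s (subst (_≋ 0ℤ) (+-identityˡ (v * + p)) (+-multiple≋ 0ℤ v))

  RecordLow : ℤ → ℕ → Set
  RecordLow v x = 0 < x × (∀ {j} → 0 < j → j < x → ⟨ v * + x ⟩[ p ] < ⟨ v * + j ⟩[ p ])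

  InD-origin⇔record : ∀ {v x} → InD p v 0ℤ (+ x) ⇔ RecordLow v x
  InD-origin⇔record {v} {x} = mk⇔ to from
    where
    to : InD p v 0ℤ (+ x) → RecordLow v x
    to (+<+ 0<x , between) = 0<x , λ {j} 0<j j<x →
      subst (_< ⟨ v * + j ⟩[ p ]) (cong (_⊔ ⟨ v * + x ⟩[ p ]) (residue-*0 v)) (between (+ j) (+<+ 0<j) (+<+ j<x))
    from : RecordLow v x → InD p v 0ℤ (+ x)
    from (0<x , low) = +<+ 0<x , between
      where
      between : ∀ n → 0ℤ ℤ.< n → n ℤ.< + x → ⟨ v * 0ℤ ⟩[ p ] ⊔ ⟨ v * + x ⟩[ p ] < ⟨ v * n ⟩[ p ]
      between (+ j) (+<+ 0<j) (+<+ j<x) =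
        subst (_< ⟨ v * + j ⟩[ p ]) (cong (_⊔ ⟨ v * + x ⟩[ p ]) (sym (residue-*0 v))) (low 0<j j<x)
      between -[1+ _ ] () _

  record-bounded : ∀ {v x} → RecordLow v x → x ≤ p
  record-bounded {v} {x} (_ , low) = ≮⇒≥ λ p<x → n≮0 (subst (⟨ v * + x ⟩[ p ] <_) (residue-*p v) (low z<s p<x))

  InD-translate : ∀ v {a b} → InD p v a b → ⟨ v * a ⟩[ p ] ≤ ⟨ v * b ⟩[ p ] → InD p v 0ℤ (b - a)
  InD-translate v {a} {b} (a<b , between) ⟨va⟩≤⟨vb⟩ = 0<b-a , between′
    where
    0<b-a : 0ℤ ℤ.< b - a
    0<b-a = subst (ℤ._< b - a) (+-inverseʳ a) (+-monoˡ-< (- a) a<b)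
    residue-shift : ∀ {c} → ⟨ v * a ⟩[ p ] ≤ ⟨ v * c ⟩[ p ] →
                    ⟨ v * (c - a) ⟩[ p ] ≡ ⟨ v * c ⟩[ p ] ∸ ⟨ v * a ⟩[ p ]
    residue-shift {c} le = trans (cong ⟨_⟩[ p ] (*-distribˡ-minus v c a)) (residue-minus (v * a) (v * c) le)
    between′ : ∀ n → 0ℤ ℤ.< n → n ℤ.< b - a → ⟨ v * 0ℤ ⟩[ p ] ⊔ ⟨ v * (b - a) ⟩[ p ] < ⟨ v * n ⟩[ p ]
    between′ n 0<n n<b-a = begin-strict
      ⟨ v * 0ℤ ⟩[ p ] ⊔ ⟨ v * (b - a) ⟩[ p ]   ≡⟨ cong (_⊔ ⟨ v * (b - a) ⟩[ p ]) (residue-*0 v) ⟩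
      ⟨ v * (b - a) ⟩[ p ]                     ≡⟨ residue-shift ⟨va⟩≤⟨vb⟩ ⟩
      ⟨ v * b ⟩[ p ] ∸ ⟨ v * a ⟩[ p ]           <⟨ ∸-monoˡ-< (m⊔n<o⇒n<o _ _ bound) ⟨va⟩≤⟨vb⟩ ⟩
      ⟨ v * (a + n) ⟩[ p ] ∸ ⟨ v * a ⟩[ p ]     ≡⟨ residue-shift (<⇒≤ (m⊔n<o⇒m<o _ _ bound)) ⟨
      ⟨ v * (a + n - a) ⟩[ p ]                 ≡⟨ cong (λ m → ⟨ v * m ⟩[ p ]) (plus-minusˡ a n) ⟩
      ⟨ v * n ⟩[ p ]                           ∎
      where
      open ≤-Reasoning
      bound : ⟨ v * a ⟩[ p ] ⊔ ⟨ v * b ⟩[ p ] < ⟨ v * (a + n) ⟩[ p ]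
      bound = between (a + n) (subst (ℤ._< a + n) (+-identityʳ a) (+-monoʳ-< a 0<n))
                              (subst (a + n ℤ.<_) (plus-minus-cancel a b) (+-monoʳ-< a n<b-a))

  InD-reflect : ∀ v {a b} → InD p v a b → InD p (- v) (- b) (- a)
  InD-reflect v {a} {b} (a<b , between) = neg-mono-< a<b , between′
    where
    residue-neg : ∀ c → ⟨ - v * - c ⟩[ p ] ≡ ⟨ v * c ⟩[ p ]
    residue-neg c = cong ⟨_⟩[ p ] (neg-*-neg v c)
    between′ : ∀ n → - b ℤ.< n → n ℤ.< - a → ⟨ - v * - b ⟩[ p ] ⊔ ⟨ - v * - a ⟩[ p ] < ⟨ - v * n ⟩[ p ]
    between′ n -b<n n<-a = subst₂ _<_
      (trans (⊔-comm ⟨ v * a ⟩[ p ] ⟨ v * b ⟩[ p ]) (sym (cong₂ _⊔_ (residue-neg b) (residue-neg a))))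
      (cong ⟨_⟩[ p ] (sym (neg-*-swap v n)))
      (between (- n) (subst (ℤ._< - n) (neg-involutive a) (neg-mono-< n<-a))
                     (subst (- n ℤ.<_) (neg-involutive b) (neg-mono-< -b<n)))

  *-inverse-cancel : ∀ x y a → x * y ≋ 1ℤ → x * (y * a) ≋ a
  *-inverse-cancel x y a xy≋1 = begin
    x * (y * a)   ≡⟨ *-rotate x y a ⟩
    a * (x * y)   ≈⟨ ≋-*ˡ a xy≋1 ⟩
    a * 1ℤ        ≡⟨ *-identityʳ a ⟩
    a             ∎
    where open SetoidReasoning ≋-setoid

  module Inverse (v w : ℤ) (vw≋1 : v * w ≋ 1ℤ) where

    residue-cancel : ∀ {a b} → ⟨ v * a ⟩[ p ] ≡ ⟨ v * b ⟩[ p ] → a ≋ b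
    residue-cancel {a} {b} ⟨va⟩≡⟨vb⟩ = begin
      a                      ≈⟨ *-inverse-cancel w v a wv≋1 ⟨
      w * (v * a)            ≈⟨ ≋-*ˡ w (≋-residue (v * a)) ⟩
      w * + ⟨ v * a ⟩[ p ]   ≡⟨ cong (λ n → w * + n) ⟨va⟩≡⟨vb⟩ ⟩
      w * + ⟨ v * b ⟩[ p ]   ≈⟨ ≋-*ˡ w (≋-residue (v * b)) ⟨
      w * (v * b)            ≈⟨ *-inverse-cancel w v b wv≋1 ⟩
      b                      ∎
      where
      open SetoidReasoning ≋-setoid
      wv≋1 : w * v ≋ 1ℤ
      wv≋1 = subst (_≋ 1ℤ) (*-comm v w) vw≋1

    residue-injective : ∀ {i j} → i < p → j < p → ⟨ v * + i ⟩[ p ] ≡ ⟨ v * + j ⟩[ p ] → i ≡ j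
    residue-injective i<p j<p eq = ≋⇒≡ i<p j<p (residue-cancel eq)

    residue-positive : ∀ {j} → 0 < j → j < p → 0 < ⟨ v * + j ⟩[ p ]
    residue-positive 0<j j<p = n≢0⇒n>0 λ ⟨vj⟩≡0 →
      >⇒≢ 0<j (residue-injective j<p z<s (trans ⟨vj⟩≡0 (sym (residue-*0 v))))

    p-record-low : RecordLow v p
    p-record-low = z<s , λ 0<j j<p → subst (_< ⟨ v * + _ ⟩[ p ]) (sym (residue-*p v)) (residue-positive 0<j j<p)

    module Link {L : ℕ → ℕ → Set} (L⇔≋ : ∀ {x y} → x < p → L x y ⇔ + x ≋ w * + y) where

      lattice⇔residue : ∀ {x y} → x < p → L x y ⇔ ⟨ v * + x ⟩[ p ] ≡ y % p
      lattice⇔residue {x} {y} x<p = mk⇔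
        (λ xy∈L → residue-cong (≋-trans (≋-*ˡ v (Equivalence.to (L⇔≋ x<p) xy∈L)) (*-inverse-cancel v w (+ y) vw≋1)))
        (λ ⟨vx⟩≡y%p → Equivalence.from (L⇔≋ x<p)
          (residue-cancel (trans ⟨vx⟩≡y%p (residue-cong (≋-sym (*-inverse-cancel v w (+ y) vw≋1))))))

      record⇒minimum : ∀ {x} → x < p → RecordLow v x → RelativeMinimum L p x
      record⇒minimum {x} x<p (0<x , low) =
        relMin 0<x x<p ⟨vx⟩ (residue-positive 0<x x<p)
          (Equivalence.from (lattice⇔residue x<p) (sym (m<n⇒m%n≡m ⟨vx⟩<p))) minimal
        where
        ⟨vx⟩ = ⟨ v * + x ⟩[ p ]
        ⟨vx⟩<p = n%ℕd<d (v * + x) p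
        minimal : ∀ {x′ y′} → 0 < x′ → x′ < x → 0 < y′ → y′ < ⟨vx⟩ → ¬ L x′ y′
        minimal {x′} {y′} 0<x′ x′<x _ y′<⟨vx⟩ x′y′∈L =
          <-asym (low 0<x′ x′<x) (subst (_< ⟨vx⟩) (sym ⟨vx′⟩≡y′) y′<⟨vx⟩)
          where
          ⟨vx′⟩≡y′ : ⟨ v * + x′ ⟩[ p ] ≡ y′
          ⟨vx′⟩≡y′ = trans (Equivalence.to (lattice⇔residue (<-trans x′<x x<p)) x′y′∈L)
                           (m<n⇒m%n≡m (<-trans y′<⟨vx⟩ ⟨vx⟩<p))

      minimum⇒record : ∀ {x} → RelativeMinimum L p x → RecordLow v x
      minimum⇒record {x} (relMin 0<x x<p y _ xy∈L minimal) = 0<x , low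
        where
        ⟨vx⟩≤y : ⟨ v * + x ⟩[ p ] ≤ y
        ⟨vx⟩≤y = ≤-trans (≤-reflexive (Equivalence.to (lattice⇔residue x<p) xy∈L)) (m%n≤m y p)
        low : ∀ {j} → 0 < j → j < x → ⟨ v * + x ⟩[ p ] < ⟨ v * + j ⟩[ p ]
        low {j} 0<j j<x with <-cmp ⟨ v * + x ⟩[ p ] ⟨ v * + j ⟩[ p ]
        ... | tri< lt _ _ = lt
        ... | tri≈ _ eq _ = contradiction (residue-injective j<p x<p (sym eq)) (<⇒≢ j<x)
          where j<p = <-trans j<x x<p
        ... | tri> _ _ gt = contradiction
              (Equivalence.from (lattice⇔residue j<p) (sym (m<n⇒m%n≡m (n%ℕd<d (v * + j) p))))
              (minimal 0<j j<x (residue-positive 0<j j<p) (<-≤-trans gt ⟨vx⟩≤y))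
          where j<p = <-trans j<x x<p

      InD-origin⇔ : ∀ x → InD p v 0ℤ (+ x) ⇔ (x ≡ p ⊎ RelativeMinimum L p x)
      InD-origin⇔ x = mk⇔ to from
        where
        to : InD p v 0ℤ (+ x) → x ≡ p ⊎ RelativeMinimum L p x
        to D with Equivalence.to (InD-origin⇔record {v} {x}) D
        ... | rec with <-cmp x p
        ...   | tri< x<p _ _ = inj₂ (record⇒minimum x<p rec)
        ...   | tri≈ _ x≡p _ = inj₁ x≡p
        ...   | tri> _ _ p<x = contradiction (record-bounded {v} rec) (<⇒≱ p<x)
        from : x ≡ p ⊎ RelativeMinimum L p x → InD p v 0ℤ (+ x)
        from (inj₁ refl) = Equivalence.from (InD-origin⇔record {v} {p}) p-record-low
        from (inj₂ m) = Equivalence.from (InD-origin⇔record {v} {x}) (minimum⇒record m)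

  lattice⁺⇔≋ : ∀ {s x y} → x < p → Lattice⁺ p s x y ⇔ + x ≋ + s * + y
  lattice⁺⇔≋ {s} {x} {y} x<p = mk⇔ to from
    where
    to : Lattice⁺ p s x y → + x ≋ + s * + y
    to (k , sy≡x+kp) = ≋-sym (begin
      + s * + y              ≡⟨ pos-* s y ⟨
      + (s ℕ.* y)            ≡⟨ cong +_ sy≡x+kp ⟩
      + (x ℕ.+ k ℕ.* p)      ≡⟨ trans (pos-+ x (k ℕ.* p)) (cong (_+_ (+ x)) (pos-* k p)) ⟩
      + x + + k * + p        ≈⟨ +-multiple≋ (+ x) (+ k) ⟩
      + x                    ∎)
      where open SetoidReasoning ≋-setoid
    from : + x ≋ + s * + y → Lattice⁺ p s x y
    from x≋sy = s ℕ.* y / p , (begin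
      s ℕ.* y                                ≡⟨ m≡m%n+[m/n]*n (s ℕ.* y) p ⟩
      s ℕ.* y % p ℕ.+ s ℕ.* y / p ℕ.* p      ≡⟨ cong (ℕ._+ s ℕ.* y / p ℕ.* p) sy%p≡x ⟩
      x ℕ.+ s ℕ.* y / p ℕ.* p                ∎)
      where
      open ≡-Reasoning
      sy%p≡x : s ℕ.* y % p ≡ x
      sy%p≡x = residue-unique x<p (subst (_≋ + x) (sym (pos-* s y)) (≋-sym x≋sy))

  lattice⁻⇔≋ : ∀ {s x y} → Lattice⁻ p s x y ⇔ + x ≋ - + s * + y
  lattice⁻⇔≋ {s} {x} {y} = mk⇔
    (λ p∣x+sy → mk≋ (subst (+ p ∣_) x+sy≡ (∣ᵤ⇒∣ p∣x+sy)))
    (λ { (mk≋ p∣) → ∣⇒∣ᵤ (subst (+ p ∣_) (sym x+sy≡) p∣) })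
    where
    x+sy≡ : + (x ℕ.+ s ℕ.* y) ≡ + x - - + s * + y
    x+sy≡ = trans (pos-+ x (s ℕ.* y)) (trans (cong (_+_ (+ x)) (pos-* s y)) (plus-minus-neg (+ x) (+ s) (+ y)))

  module Gaps (u : ℤ) (r₁ : ℕ) (ur₁≋1 : u * + r₁ ≋ 1ℤ) where

    open Inverse u (+ r₁) ur₁≋1 using () renaming (module Link to Link⁺)
    open Inverse (- u) (- + r₁) (subst (_≋ 1ℤ) (sym (neg-*-neg u (+ r₁))) ur₁≋1) using () renaming (module Link to Link⁻)
    open Link⁺ {Lattice⁺ p r₁} (lattice⁺⇔≋ {r₁}) using () renaming (InD-origin⇔ to InD-origin⇔⁺)
    open Link⁻ {Lattice⁻ p r₁} (λ _ → lattice⁻⇔≋ {r₁}) using () renaming (InD-origin⇔ to InD-origin⇔⁻)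

    InD-origin⇒gap⁺ : ∀ {d} → InD p u 0ℤ d → ∃[ x ] d ≡ + x × IsGap p r₁ x
    InD-origin⇒gap⁺ {+ x} D = x , refl , [ inj₁ , inj₂ ∘ inj₁ ]′ (Equivalence.to (InD-origin⇔⁺ x) D)
    InD-origin⇒gap⁺ { -[1+ _ ]} (() , _)

    InD-origin⇒gap⁻ : ∀ {d} → InD p (- u) 0ℤ d → ∃[ x ] d ≡ + x × IsGap p r₁ x
    InD-origin⇒gap⁻ {+ x} D = x , refl , [ inj₁ , inj₂ ∘ inj₂ ]′ (Equivalence.to (InD-origin⇔⁻ x) D)
    InD-origin⇒gap⁻ { -[1+ _ ]} (() , _)

    InDΔ⇒gap : ∀ {d} → InDΔ p u d → ∃[ x ] d ≡ + x × IsGap p r₁ x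
    InDΔ⇒gap (a , b , ab∈D , b-a≡d) with ≤-total ⟨ u * a ⟩[ p ] ⟨ u * b ⟩[ p ]
    ... | inj₁ ⟨ua⟩≤⟨ub⟩ = InD-origin⇒gap⁺ (subst (InD p u 0ℤ) b-a≡d (InD-translate u ab∈D ⟨ua⟩≤⟨ub⟩))
    ... | inj₂ ⟨ub⟩≤⟨ua⟩ = InD-origin⇒gap⁻ (subst (InD p (- u) 0ℤ) (trans (neg-minus-neg a b) b-a≡d)
            (InD-translate (- u) (InD-reflect u ab∈D) (subst₂ _≤_ (residue-neg b) (residue-neg a) ⟨ub⟩≤⟨ua⟩)))
      where
      residue-neg : ∀ c → ⟨ u * c ⟩[ p ] ≡ ⟨ - u * - c ⟩[ p ]
      residue-neg c = cong ⟨_⟩[ p ] (sym (neg-*-neg u c))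

    gap⇒InDΔ : ∀ {x} → IsGap p r₁ x → InDΔ p u (+ x)
    gap⇒InDΔ {x} (inj₁ x≡p) = 0ℤ , + x , Equivalence.from (InD-origin⇔⁺ x) (inj₁ x≡p) , +-identityʳ (+ x)
    gap⇒InDΔ {x} (inj₂ (inj₁ m)) = 0ℤ , + x , Equivalence.from (InD-origin⇔⁺ x) (inj₂ m) , +-identityʳ (+ x)
    gap⇒InDΔ {x} (inj₂ (inj₂ m)) =
      - + x , 0ℤ ,
      subst (λ v → InD p v (- + x) 0ℤ) (neg-involutive u)
        (InD-reflect (- u) (Equivalence.from (InD-origin⇔⁻ x) (inj₂ m))) ,
      trans (+-identityˡ (- - + x)) (neg-involutive (+ x))

    InDΔ⇔gap : ∀ d → InDΔ p u d ⇔ (∃[ x ] d ≡ + x × IsGap p r₁ x)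
    InDΔ⇔gap d = mk⇔ InDΔ⇒gap λ { (x , refl , gap) → gap⇒InDΔ gap }

open import Data.Nat as ℕ using (ℕ)
open import Data.Integer as ℤ using (ℤ; +_; _-_; _*_)
open import Data.Integer.Divisibility using (_∣_)
open import Data.Integer.Coprimality using (Coprime)
open import Relation.Binary.PropositionalEquality using (_≡_)
open import Function.Bundles using (_⇔_)

open import Data.Nat.Base using (suc; zero; s≤s; z≤n)
import Data.Nat.Properties as ℕₚ
open import Data.Nat.DivMod using (m/n*n≤m)
open import Data.Integer.Properties using (pos-*; [+m]-[+n]≡m⊖n; ⊖-≥)
open import Data.Integer.Divisibility.Signed using (∣ᵤ⇒∣)
open import Data.Product using (_×_; _,_; ∃-syntax)
open import Data.Product.Function.NonDependent.Propositional using (_×-⇔_)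
open import Data.Product.Function.Dependent.Propositional using (Σ-⇔)
open import Function.Bundles using (mk⇔)
open import Function.Construct.Identity using (⇔-id; ↠-id)
open import Function.Properties.Equivalence using (⇔-setoid)
open import Level using (0ℓ)
open import Relation.Binary.PropositionalEquality using (refl; sym; trans; cong)
import Relation.Binary.Reasoning.Setoid as SetoidReasoning
open LatticeMinima using (IsGap; EuclidGaps; gap⇔euclid)

<divN⇒*≤ : ∀ {z a b} → z ℕ.< divN a b → z ℕ.* b ℕ.≤ a
<divN⇒*≤ {b = zero} ()
<divN⇒*≤ {z} {a} {suc b} z<a/b = ℕₚ.≤-trans (ℕₚ.*-monoˡ-≤ (suc b) (ℕₚ.<⇒≤ z<a/b)) (m/n*n≤m a (suc b))

euclid-term : ∀ {x} z {b a} → x ℕ.+ z ℕ.* b ≡ a → + a - + z * + b ≡ + x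
euclid-term {x} z {b} refl = begin
  + (x ℕ.+ z ℕ.* b) - + z * + b        ≡⟨ cong (+ (x ℕ.+ z ℕ.* b) -_) (pos-* z b) ⟨
  + (x ℕ.+ z ℕ.* b) - + (z ℕ.* b)      ≡⟨ [+m]-[+n]≡m⊖n (x ℕ.+ z ℕ.* b) (z ℕ.* b) ⟩
  (x ℕ.+ z ℕ.* b) ℤ.⊖ (z ℕ.* b)        ≡⟨ ⊖-≥ (ℕₚ.m≤n+m (z ℕ.* b) x) ⟩
  + (x ℕ.+ z ℕ.* b ℕ.∸ z ℕ.* b)        ≡⟨ cong +_ (ℕₚ.m+n∸n≡m x (z ℕ.* b)) ⟩
  + x                                  ∎
  where open Relation.Binary.PropositionalEquality.≡-Reasoning

InEuc⇔EuclidGaps : ∀ p s t d → InEuc p s t d ⇔ (∃[ x ] d ≡ + x × EuclidGaps p s t x)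
InEuc⇔EuclidGaps p s t d = mk⇔ to from
  where
  to : InEuc p s t d → ∃[ x ] d ≡ + x × EuclidGaps p s t x
  to (suc i , z , _ , i<t , z<Z , d≡) = _ , trans d≡ (euclid-term z x+zb≡a) , i , i<t , z , z<Z , x+zb≡a
    where x+zb≡a = ℕₚ.m∸n+n≡m (<divN⇒*≤ z<Z)
  from : (∃[ x ] d ≡ + x × EuclidGaps p s t x) → InEuc p s t d
  from (x , refl , i , i<t , z , z<Z , x+zb≡a) = suc i , z , s≤s z≤n , i<t , z<Z , sym (euclid-term z x+zb≡a)

mainTheorem4 : (p : ℕ) (u : ℤ) (r1 t : ℕ) →
    3 ℕ.≤ p → Coprime u (+ p) →
    0 ℕ.< r1 → r1 ℕ.< p → (+ p) ∣ (u * + r1 - + 1) →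
    r p r1 t ≡ 1 →
    (d : ℤ) → InDΔ p u d ⇔ InEuc p r1 t d
mainTheorem4 p@(suc k) u r1 t (s≤s _) _ 0<r1 r1<p p∣ur1-1 rt d = begin
  InDΔ p u d                                ≈⟨ InDΔ⇔gap d ⟩
  (∃[ x ] d ≡ + x × IsGap p r1 x)           ≈⟨ Σ-⇔ (↠-id ℕ) (⇔-id _ ×-⇔ gap⇔euclid t 0<r1 r1<p rt _) ⟩
  (∃[ x ] d ≡ + x × EuclidGaps p r1 t x)    ≈⟨ InEuc⇔EuclidGaps p r1 t d ⟨
  InEuc p r1 t d                            ∎
  where
  open SetoidReasoning (⇔-setoid 0ℓ)
  open Residues.Gaps k u r1 (Residues.mk≋ (∣ᵤ⇒∣ p∣ur1-1))
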